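{- Let $r,s$ be integers with $1\le r\le s$, and let $m,n$ be integers with $2s\le m\le n<2(r+s)$. Then the graph of an $\{r,s\}$-leaper on an $m\times n$ board has no Hamiltonian circuit.
   Context: For positive integers $r,s$, the graph of an $\{r,s\}$-leaper on an $m\times n$ board has vertex set $\{(x,y): 0\le x<m,\ 0\le y<n\}$ (integers), with an edge between $(x,y)$ and $(x',y')$ whenever $(x'-x,y'-y)\in\{(\pm r,\pm s),(\pm s,\pm r)\}$. The paper's convention is $1\le r\le s$. A Hamiltonian circuit is a cycle passing through every vertex exactly once. -}

module Defs where

open import Data.Nat using (ℕ; suc; _*_; _≤_; ∣_-_∣)
open import Data.Nat.DivMod using (_%_)
open import Data.Fin using (Fin; toℕ; fromℕ<)
open import Data.Nat.DivMod using (m%n<n)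
open import Data.Product using (_×_; _,_; Σ; ∃)
open import Data.Sum using (_⊎_)
open import Relation.Binary.PropositionalEquality using (_≡_)
open import Function.Definitions using (Injective; Surjective)

Square : ℕ → ℕ → Set
Square m n = Fin m × Fin n

LeaperAdj : (r s : ℕ) {m n : ℕ} → Square m n → Square m n → Set
LeaperAdj r s (x , y) (x' , y') =
  (∣ toℕ x - toℕ x' ∣ ≡ r × ∣ toℕ y - toℕ y' ∣ ≡ s)
  ⊎ (∣ toℕ x - toℕ x' ∣ ≡ s × ∣ toℕ y - toℕ y' ∣ ≡ r)

next : {k : ℕ} → Fin (suc k) → Fin (suc k)
next {k} i = fromℕ< (m%n<n (suc (toℕ i)) (suc k))

record HamiltonianCircuit {V : Set} (E : V → V → Set) : Set where
  field
    len     : ℕ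
    len≥3   : 3 ≤ suc len
    vertex  : Fin (suc len) → V
    inj     : Injective _≡_ _≡_ vertex
    surj    : Surjective _≡_ _≡_ vertex
    step    : ∀ i → E (vertex i) (vertex (next i))

LeaperGraphHasHamCircuit : (r s m n : ℕ) → Set
LeaperGraphHasHamCircuit r s m n =
  HamiltonianCircuit (LeaperAdj r s {m} {n})

-- Colour the board by the parity of x + y. If r + s is even every move keeps the colour, and if
-- d = gcd(r, s) > 1 every move keeps x mod d, so the leaper graph is disconnected. Otherwise every
-- move changes colour, a circuit has even length, and m, n cannot both be odd. So say m is even;
-- as m < 2(r + s), numbering the columns by a z (mod r + s), where a r ≡ 1, and keeping those with
-- an odd number (for one of two offsets) gives m/2 columns no two of which are r or s apart.
-- Their squares are half the board and pairwise non-adjacent, so a circuit alternates between them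
-- and the rest; as it also alternates colours, the sum of the two indicators is constant along it,
-- which fails for two vertically adjacent squares. The hypothesis 2s ≤ m only serves to make m ≥ 2.
module Submission where

open import Defs
open import Data.Nat.Properties
open import Algebra.Properties.CommutativeMonoid.Sum +-0-commutativeMonoid
  using (sum; sum-syntax; sum-cong-≗; sum-init-last; sum-remove; sum-permute; ∑-distrib-+; ∑-comm)
open import Data.Fin using (Fin; zero; suc; toℕ; fromℕ; inject₁; _↑ˡ_; _↑ʳ_; combine; remQuot)
open import Data.Fin.Induction using (<-weakInduction)
open import Data.Fin.Permutation using (Permutation; ↔⇒≡; _⟨$⟩ʳ_)
open import Data.Fin.Properties using (toℕ-injective; toℕ-fromℕ<; toℕ-fromℕ; toℕ-inject₁; toℕ<n; remQuot-combine; *↔×)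
open import Data.List using (_∷_; [])
open import Data.Nat using (ℕ; zero; suc; _+_; _*_; _≤_; _<_; ∣_-_∣; z≤n; s≤s; z<s; NonZero; _≤?_; parity)
open import Data.Nat.DivMod
  using (_%_; _/_; %-distribˡ-+; %-remove-+ʳ; m%n%n≡m%n; m%n<n; m<n⇒m%n≡m; n%n≡0; [m+n]%n≡m%n; [m+kn]%n≡m%n; m≡m%n+[m/n]*n)
open import Data.Nat.Divisibility using (_∣_; divides; ∣m+n∣m⇒∣n; ∣m⇒∣m*n; n∣m*n; m%n≡0⇒n∣m; 0∣⇒≡0)
open import Data.Nat.GCD using (module GCD; module Bézout)
open import Data.Nat.Tactic.RingSolver using (solve; solve-∀)
open import Data.Parity.Base as ℙ using (Parity; 0ℙ; 1ℙ; _⁻¹)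
import Data.Parity.Properties as ℙₚ
open import Algebra.Properties.CommutativeSemigroup ℙₚ.+-commutativeSemigroup using (interchange)
open import Data.Product using (Σ-syntax; ∃-syntax; _×_; _,_; proj₁; proj₂; swap)
open import Data.Sum using (_⊎_; inj₁; inj₂) renaming (swap to ⊎-swap)
open import Data.Vec.Functional using (removeAt)
open import Function using (_∘_)
open import Function.Bundles using (mk⤖)
open import Function.Properties.Bijection using (⤖⇒↔)
open import Function.Properties.Inverse using (↔-sym; ↔-trans)
open import Relation.Binary.PropositionalEquality
open import Relation.Nullary using (¬_; yes; no; contradiction)

sum-const : ∀ k c → ∑[ i < k ] c ≡ k * c
sum-const zero    c = refl
sum-const (suc k) c = cong (c +_) (sum-const k c)

sum-↑ : ∀ k l (f : Fin (k + l) → ℕ) → sum f ≡ sum (f ∘ (_↑ˡ l)) + sum (f ∘ (k ↑ʳ_))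
sum-↑ zero    l f = refl
sum-↑ (suc k) l f = trans (cong (f zero +_) (sum-↑ k l (f ∘ suc))) (sym (+-assoc (f zero) _ _))

sum-combine : ∀ k l (f : Fin (k * l) → ℕ) → sum f ≡ ∑[ i < k ] ∑[ j < l ] f (combine i j)
sum-combine zero    l f = refl
sum-combine (suc k) l f =
  trans (sum-↑ l (k * l) f) (cong (sum (f ∘ (_↑ˡ k * l)) +_) (sum-combine k l (f ∘ (l ↑ʳ_))))

sum-≤-length : ∀ {k} (f : Fin k → ℕ) → (∀ i → f i ≤ 1) → sum f ≤ k
sum-≤-length {zero}  f f≤1 = z≤n
sum-≤-length {suc k} f f≤1 = +-mono-≤ (f≤1 zero) (sum-≤-length (f ∘ suc) (f≤1 ∘ suc))

sum-≥-length : ∀ {k} (f : Fin k → ℕ) → (∀ i → 1 ≤ f i) → k ≤ sum f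
sum-≥-length {zero}  f f≥1 = z≤n
sum-≥-length {suc k} f f≥1 = +-mono-≤ (f≥1 zero) (sum-≥-length (f ∘ suc) (f≥1 ∘ suc))

sum-≥-length⇒≡1 : ∀ {k} (f : Fin k → ℕ) → (∀ i → f i ≤ 1) → k ≤ sum f → ∀ i → f i ≡ 1
sum-≥-length⇒≡1 {suc k} f f≤1 k≤Σ i = ≤-antisym (f≤1 i) (+-cancelʳ-≤ k 1 (f i) (begin
  suc k                     ≤⟨ k≤Σ ⟩
  sum f                     ≡⟨ sum-remove {i = i} f ⟩
  f i + sum (removeAt f i)  ≤⟨ +-monoʳ-≤ (f i) (sum-≤-length _ (λ j → f≤1 _)) ⟩
  f i + k                   ∎))
  where open ≤-Reasoning

sum-≥-length-but-one : ∀ {k} (f : Fin k → ℕ) e → (∀ i → toℕ i ≢ e → 1 ≤ f i) → k ≤ suc (sum f)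
sum-≥-length-but-one {zero}  f e       f≥1 = z≤n
sum-≥-length-but-one {suc k} f zero    f≥1 =
  s≤s (≤-trans (sum-≥-length (f ∘ suc) (λ i → f≥1 (suc i) (λ ()))) (m≤n+m (sum (f ∘ suc)) (f zero)))
sum-≥-length-but-one {suc k} f (suc e) f≥1 =
  s≤s (≤-trans (sum-≥-length-but-one (f ∘ suc) e (λ i i≢e → f≥1 (suc i) (i≢e ∘ suc-injective)))
               (+-monoˡ-≤ (sum (f ∘ suc)) (f≥1 zero (λ ()))))

h+h≤1+p+q⇒h≤p⊎h≤q : ∀ h p q → h + h ≤ suc (p + q) → h ≤ p ⊎ h ≤ q
h+h≤1+p+q⇒h≤p⊎h≤q h p q h+h≤1+p+q with h ≤? p | h ≤? q
... | yes h≤p | _       = inj₁ h≤p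
... | no _    | yes h≤q = inj₂ h≤q
... | no h≰p  | no h≰q  =
  contradiction h+h≤1+p+q (<⇒≱ (subst (_≤ h + h) (+-suc (suc p) q) (+-mono-≤ (≰⇒> h≰p) (≰⇒> h≰q))))

toℕ-next : ∀ {k} (i : Fin (suc k)) → toℕ (next i) ≡ suc (toℕ i) % suc k
toℕ-next i = toℕ-fromℕ< _

next-inject₁ : ∀ {k} (i : Fin k) → next (inject₁ i) ≡ suc i
next-inject₁ {k} i = toℕ-injective (begin
  toℕ (next (inject₁ i))         ≡⟨ toℕ-next (inject₁ i) ⟩
  suc (toℕ (inject₁ i)) % suc k  ≡⟨ cong (λ j → suc j % suc k) (toℕ-inject₁ i) ⟩
  suc (toℕ i) % suc k            ≡⟨ m<n⇒m%n≡m (s≤s (toℕ<n i)) ⟩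
  suc (toℕ i)                    ∎)
  where open ≡-Reasoning

next-fromℕ : ∀ k → next (fromℕ k) ≡ zero
next-fromℕ k = toℕ-injective (begin
  toℕ (next (fromℕ k))         ≡⟨ toℕ-next (fromℕ k) ⟩
  suc (toℕ (fromℕ k)) % suc k  ≡⟨ cong (λ j → suc j % suc k) (toℕ-fromℕ k) ⟩
  suc k % suc k                ≡⟨ n%n≡0 (suc k) ⟩
  0                            ∎)
  where open ≡-Reasoning

next-invariant⇒constant : ∀ {k} {A : Set} (f : Fin (suc k) → A) → (∀ i → f (next i) ≡ f i) → ∀ i → f i ≡ f zero
next-invariant⇒constant f invariant =
  <-weakInduction (λ i → f i ≡ f zero) refl
    (λ i f[i]≡f[0] → trans (cong f (sym (next-inject₁ i))) (trans (invariant (inject₁ i)) f[i]≡f[0]))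

sum-∘-next : ∀ {k} (f : Fin (suc k) → ℕ) → sum (f ∘ next) ≡ sum f
sum-∘-next {k} f = begin
  sum (f ∘ next)                                 ≡⟨ sum-init-last (f ∘ next) ⟩
  sum (f ∘ next ∘ inject₁) + f (next (fromℕ k))
    ≡⟨ cong₂ _+_ (sum-cong-≗ (cong f ∘ next-inject₁)) (cong f (next-fromℕ k)) ⟩
  sum (f ∘ suc) + f zero                         ≡⟨ +-comm (sum (f ∘ suc)) (f zero) ⟩
  sum f                                          ∎
  where open ≡-Reasoning

p+[p+q]≡q : ∀ p q → p ℙ.+ (p ℙ.+ q) ≡ q
p+[p+q]≡q p q = trans (sym (ℙₚ.+-assoc p p q)) (cong (ℙ._+ q) (ℙₚ.p+p≡0ℙ p))

+≡0ℙ⇒≡ : ∀ p q → p ℙ.+ q ≡ 0ℙ → q ≡ p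
+≡0ℙ⇒≡ p q p+q≡0 = trans (sym (p+[p+q]≡q p q)) (trans (cong (p ℙ.+_) p+q≡0) (ℙₚ.+-identityʳ p))

parity-suc : ∀ n → parity (suc n) ≡ parity n ⁻¹
parity-suc n = ℙₚ.+-homo-+ 1 n

even⇒double : ∀ m → parity m ≡ 0ℙ → ∃[ h ] m ≡ h + h
even⇒double zero          _    = 0 , refl
even⇒double (suc (suc m)) even with even⇒double m even
... | h , refl = suc h , cong suc (sym (+-suc h h))

weight : Parity → ℕ
weight 0ℙ = 0
weight 1ℙ = 1

oddCount : ∀ {k} → (Fin k → Parity) → ℕ
oddCount p = ∑[ i < _ ] weight (p i)

weight-+≡1ℙ : ∀ p q → p ℙ.+ q ≡ 1ℙ → weight p + weight q ≡ 1
weight-+≡1ℙ 0ℙ 1ℙ _ = refl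
weight-+≡1ℙ 1ℙ 0ℙ _ = refl

weight-*≡0ℙ : ∀ p q → p ℙ.* q ≡ 0ℙ → weight p + weight q ≤ 1
weight-*≡0ℙ 0ℙ 0ℙ _ = z≤n
weight-*≡0ℙ 0ℙ 1ℙ _ = ≤-refl
weight-*≡0ℙ 1ℙ 0ℙ _ = ≤-refl

weight≡1⇒+≡1ℙ : ∀ p q → weight p + weight q ≡ 1 → p ℙ.+ q ≡ 1ℙ
weight≡1⇒+≡1ℙ 0ℙ 1ℙ _ = refl
weight≡1⇒+≡1ℙ 1ℙ 0ℙ _ = refl

module _ {k : ℕ} (p : Fin (suc k) → Parity) where

  Alternating : Set
  Alternating = ∀ i → p i ℙ.+ p (next i) ≡ 1ℙ

  private
    pairWeight : Fin (suc k) → ℕ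
    pairWeight i = weight (p i) + weight (p (next i))

    sum-pairWeight : sum pairWeight ≡ oddCount p + oddCount p
    sum-pairWeight = trans (∑-distrib-+ (weight ∘ p) (weight ∘ p ∘ next))
                           (cong (oddCount p +_) (sum-∘-next (weight ∘ p)))

  alternating⇒length≡2*oddCount : Alternating → suc k ≡ oddCount p + oddCount p
  alternating⇒length≡2*oddCount alternating = begin
    suc k                    ≡⟨ sym (*-identityʳ (suc k)) ⟩
    suc k * 1                ≡⟨ sym (sum-const (suc k) 1) ⟩
    ∑[ i < suc k ] 1         ≡⟨ sum-cong-≗ (λ i → sym (weight-+≡1ℙ (p i) (p (next i)) (alternating i))) ⟩
    sum pairWeight           ≡⟨ sum-pairWeight ⟩
    oddCount p + oddCount p  ∎
    where open ≡-Reasoning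

  -- Each of the k + 1 cyclically consecutive pairs holds at most one odd entry, and the pairs count
  -- every entry twice.
  sparse∧half-odd⇒alternating : (∀ i → p i ℙ.* p (next i) ≡ 0ℙ) → suc k ≤ oddCount p + oddCount p → Alternating
  sparse∧half-odd⇒alternating sparse half-odd i =
    weight≡1⇒+≡1ℙ (p i) (p (next i))
      (sum-≥-length⇒≡1 pairWeight (λ j → weight-*≡0ℙ (p j) (p (next j)) (sparse j))
                                  (subst (suc k ≤_) (sym sum-pairWeight) half-odd) i)

module Circuit {V : Set} {E : V → V → Set} (H : HamiltonianCircuit E) where
  open HamiltonianCircuit H

  constant-on-circuit : {A : Set} (f : V → A) → (∀ i → f (vertex (next i)) ≡ f (vertex i)) → ∀ u w → f u ≡ f w
  constant-on-circuit f invariant u w = begin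
    f u                          ≡⟨ cong f (sym (proj₂ (surj u) refl)) ⟩
    f (vertex (proj₁ (surj u)))  ≡⟨ constant (proj₁ (surj u)) ⟩
    f (vertex zero)              ≡⟨ sym (constant (proj₁ (surj w))) ⟩
    f (vertex (proj₁ (surj w)))  ≡⟨ cong f (proj₂ (surj w) refl) ⟩
    f w                          ∎
    where
    open ≡-Reasoning
    constant : ∀ i → f (vertex i) ≡ f (vertex zero)
    constant = next-invariant⇒constant (f ∘ vertex) invariant

module BoardCircuit {m n : ℕ} {E : Square m n → Square m n → Set} (H : HamiltonianCircuit E) where
  open HamiltonianCircuit H

  circuit↔cells : Permutation (suc len) (m * n)
  circuit↔cells = ↔-trans (⤖⇒↔ (mk⤖ (inj , surj))) (↔-sym *↔×)

  circuit-length : suc len ≡ m * n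
  circuit-length = ↔⇒≡ circuit↔cells

  sum-along-circuit : (g : Square m n → ℕ) → ∑[ i < suc len ] g (vertex i) ≡ ∑[ x < m ] ∑[ y < n ] g (x , y)
  sum-along-circuit g = begin
    ∑[ i < suc len ] g (vertex i)
      ≡⟨ sum-cong-≗ (λ i → cong g (sym (remQuot-combine (proj₁ (vertex i)) (proj₂ (vertex i))))) ⟩
    ∑[ i < suc len ] g (remQuot n (circuit↔cells ⟨$⟩ʳ i))
      ≡⟨ sym (sum-permute (g ∘ remQuot n) circuit↔cells) ⟩
    sum (g ∘ remQuot n)
      ≡⟨ sum-combine m n (g ∘ remQuot n) ⟩
    ∑[ x < m ] ∑[ y < n ] g (remQuot n (combine x y))
      ≡⟨ sum-cong-≗ (λ x → sum-cong-≗ (λ y → cong g (remQuot-combine x y))) ⟩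
    ∑[ x < m ] ∑[ y < n ] g (x , y)
      ∎
    where open ≡-Reasoning

  oddCount-columns : (B : Fin m → Parity) → oddCount (B ∘ proj₁ ∘ vertex) ≡ n * oddCount B
  oddCount-columns B = begin
    oddCount (B ∘ proj₁ ∘ vertex)       ≡⟨ sum-along-circuit (weight ∘ B ∘ proj₁) ⟩
    ∑[ x < m ] ∑[ y < n ] weight (B x)  ≡⟨ ∑-comm {m} {n} (λ x y → weight (B x)) ⟩
    ∑[ y < n ] oddCount B               ≡⟨ sum-const n (oddCount B) ⟩
    n * oddCount B                      ∎
    where open ≡-Reasoning

∣m-n∣≡o⇒n≡m+o⊎m≡n+o : ∀ m n {o} → ∣ m - n ∣ ≡ o → n ≡ m + o ⊎ m ≡ n + o
∣m-n∣≡o⇒n≡m+o⊎m≡n+o m n refl with ≤-total m n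
... | inj₁ m≤n = inj₁ (trans (sym (m+[n∸m]≡n m≤n)) (cong (m +_) (sym (m≤n⇒∣m-n∣≡n∸m m≤n))))
... | inj₂ n≤m = inj₂ (trans (sym (m+[n∸m]≡n n≤m)) (cong (n +_) (sym (m≤n⇒∣n-m∣≡n∸m n≤m))))

parity-∣-∣ : ∀ m n {o} → ∣ m - n ∣ ≡ o → parity m ℙ.+ parity n ≡ parity o
parity-∣-∣ m n {o} dist with ∣m-n∣≡o⇒n≡m+o⊎m≡n+o m n dist
... | inj₁ refl = trans (cong (parity m ℙ.+_) (ℙₚ.+-homo-+ m o)) (p+[p+q]≡q (parity m) (parity o))
... | inj₂ refl = trans (cong (ℙ._+ parity n) (ℙₚ.+-homo-+ n o))
                        (trans (ℙₚ.+-comm (parity n ℙ.+ parity o) (parity n)) (p+[p+q]≡q (parity n) (parity o)))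

%-∣-∣ : ∀ m n {o} d .{{_ : NonZero d}} → d ∣ o → ∣ m - n ∣ ≡ o → m % d ≡ n % d
%-∣-∣ m n d d∣o dist with ∣m-n∣≡o⇒n≡m+o⊎m≡n+o m n dist
... | inj₁ refl = sym (%-remove-+ʳ m d∣o)
... | inj₂ refl = %-remove-+ʳ n d∣o

[m+n%d]%d≡[m+n]%d : ∀ m n d .{{_ : NonZero d}} → (m + n % d) % d ≡ (m + n) % d
[m+n%d]%d≡[m+n]%d m n d = begin
  (m + n % d) % d          ≡⟨ %-distribˡ-+ m (n % d) d ⟩
  (m % d + n % d % d) % d  ≡⟨ cong (λ k → (m % d + k) % d) (m%n%n≡m%n n d) ⟩
  (m % d + n % d) % d      ≡⟨ sym (%-distribˡ-+ m n d) ⟩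
  (m + n) % d              ∎
  where open ≡-Reasoning

parity-*-suc-% : ∀ {u M} .{{_ : NonZero M}} → u < M → parity u ℙ.* parity (suc u % M) ≡ 0ℙ
parity-*-suc-% {u} u<M with m≤n⇒m<n∨m≡n u<M
... | inj₁ 1+u<M = trans (cong (λ k → parity u ℙ.* parity k) (m<n⇒m%n≡m 1+u<M))
                         (trans (cong (parity u ℙ.*_) (parity-suc u)) (ℙₚ.p*p⁻¹≡0ℙ (parity u)))
... | inj₂ refl  = trans (cong (λ k → parity u ℙ.* parity k) (n%n≡0 (suc u))) (ℙₚ.*-zeroʳ (parity u))

n∣m∧0<m<n+n⇒m≡n : ∀ {m n} → n ∣ m → 0 < m → m < n + n → m ≡ n
n∣m∧0<m<n+n⇒m≡n {n = n} (divides 1 refl) _ _ = +-identityʳ n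
n∣m∧0<m<n+n⇒m≡n {n = n} (divides (suc (suc q)) refl) _ m<n+n =
  contradiction m<n+n (≤⇒≯ (+-monoʳ-≤ n (m≤m+n n (q * n))))

1%[1+r+s]≡1 : ∀ r s → 1 ≤ s → 1 % (suc r + s) ≡ 1
1%[1+r+s]≡1 r s 1≤s = m<n⇒m%n≡m (s≤s (≤-trans 1≤s (m≤n+m s r)))

-- Leaper moves and the four obstructions

colour : ∀ {m n} → Square m n → Parity
colour (x , y) = parity (toℕ x) ℙ.+ parity (toℕ y)

colour-step : ∀ {r s m n} (u v : Square m n) → LeaperAdj r s u v → colour u ℙ.+ colour v ≡ parity (r + s)
colour-step {r} {s} (x , y) (x' , y') adj = begin
  (parity (toℕ x) ℙ.+ parity (toℕ y)) ℙ.+ (parity (toℕ x') ℙ.+ parity (toℕ y'))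
    ≡⟨ interchange (parity (toℕ x)) (parity (toℕ y)) (parity (toℕ x')) (parity (toℕ y')) ⟩
  (parity (toℕ x) ℙ.+ parity (toℕ x')) ℙ.+ (parity (toℕ y) ℙ.+ parity (toℕ y'))
    ≡⟨ displacement adj ⟩
  parity r ℙ.+ parity s
    ≡⟨ sym (ℙₚ.+-homo-+ r s) ⟩
  parity (r + s)
    ∎
  where
  open ≡-Reasoning
  displacement : LeaperAdj r s (x , y) (x' , y') →
                 (parity (toℕ x) ℙ.+ parity (toℕ x')) ℙ.+ (parity (toℕ y) ℙ.+ parity (toℕ y')) ≡ parity r ℙ.+ parity s
  displacement (inj₁ (dx , dy)) = cong₂ ℙ._+_ (parity-∣-∣ (toℕ x) (toℕ x') dx) (parity-∣-∣ (toℕ y) (toℕ y') dy)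
  displacement (inj₂ (dx , dy)) = trans (cong₂ ℙ._+_ (parity-∣-∣ (toℕ x) (toℕ x') dx) (parity-∣-∣ (toℕ y) (toℕ y') dy))
                                        (ℙₚ.+-comm (parity s) (parity r))

column-step : ∀ {r s m n} (u v : Square m n) → LeaperAdj r s u v →
              ∣ toℕ (proj₁ u) - toℕ (proj₁ v) ∣ ≡ r ⊎ ∣ toℕ (proj₁ u) - toℕ (proj₁ v) ∣ ≡ s
column-step _ _ (inj₁ (dx , _)) = inj₁ dx
column-step _ _ (inj₂ (dx , _)) = inj₂ dx

column-residue-step : ∀ {r s m n} (u v : Square m n) d .{{_ : NonZero d}} → d ∣ r → d ∣ s → LeaperAdj r s u v →
                      toℕ (proj₁ u) % d ≡ toℕ (proj₁ v) % d
column-residue-step (x , y) (x' , y') d d∣r d∣s adj with column-step (x , y) (x' , y') adj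
... | inj₁ dx = %-∣-∣ (toℕ x) (toℕ x') d d∣r dx
... | inj₂ dx = %-∣-∣ (toℕ x) (toℕ x') d d∣s dx

leaper-transpose : ∀ {r s m n} → LeaperGraphHasHamCircuit r s m n → LeaperGraphHasHamCircuit r s n m
leaper-transpose H = record
  { len    = len
  ; len≥3  = len≥3
  ; vertex = swap ∘ vertex
  ; inj    = inj ∘ cong swap
  ; surj   = λ v → proj₁ (surj (swap v)) , cong swap ∘ proj₂ (surj (swap v))
  ; step   = λ i → transpose-step (vertex i) (vertex (next i)) (step i)
  }
  where
  open HamiltonianCircuit H
  transpose-step : ∀ {r s m n} (u v : Square m n) → LeaperAdj r s u v → LeaperAdj r s (swap u) (swap v)
  transpose-step _ _ (inj₁ (dx , dy)) = inj₂ (dy , dx)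
  transpose-step _ _ (inj₂ (dx , dy)) = inj₁ (dy , dx)

column-colours-differ : ∀ {m n} (b : Parity) (x : Fin m) →
                        b ℙ.+ colour {m} {suc (suc n)} (x , zero) ≢ b ℙ.+ colour {m} {suc (suc n)} (x , suc zero)
column-colours-differ b x eq with ℙₚ.+-cancelˡ-≡ (parity (toℕ x)) 0ℙ 1ℙ (ℙₚ.+-cancelˡ-≡ b _ _ eq)
... | ()

even-leaper-no-circuit : ∀ {r s m n} → parity (r + s) ≡ 0ℙ → 2 ≤ n → ¬ LeaperGraphHasHamCircuit r s m n
even-leaper-no-circuit {n = suc (suc n-2)} even (s≤s (s≤s z≤n)) H =
  column-colours-differ {n = n-2} 0ℙ x₀ (constant-on-circuit colour colour-invariant (x₀ , zero) (x₀ , suc zero))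
  where
  open HamiltonianCircuit H
  open Circuit H
  x₀ = proj₁ (vertex zero)
  colour-invariant : ∀ i → colour (vertex (next i)) ≡ colour (vertex i)
  colour-invariant i = +≡0ℙ⇒≡ _ _ (trans (colour-step (vertex i) (vertex (next i)) (step i)) even)

common-divisor-no-circuit : ∀ {r s m n d} → 2 ≤ d → d ∣ r → d ∣ s → 2 ≤ m → ¬ LeaperGraphHasHamCircuit r s m n
common-divisor-no-circuit {m = suc (suc _)} {n} {d = suc (suc d)} (s≤s (s≤s z≤n)) d∣r d∣s (s≤s (s≤s z≤n)) H =
  0≢1 (constant-on-circuit residue residue-invariant (zero , y₀) (suc zero , y₀))
  where
  open HamiltonianCircuit H
  open Circuit H
  y₀ = proj₂ (vertex zero)
  residue : Square _ n → ℕ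
  residue v = toℕ (proj₁ v) % suc (suc d)
  residue-invariant : ∀ i → residue (vertex (next i)) ≡ residue (vertex i)
  residue-invariant i = sym (column-residue-step (vertex i) (vertex (next i)) (suc (suc d)) d∣r d∣s (step i))
  0≢1 : 0 % suc (suc d) ≢ 1 % suc (suc d)
  0≢1 ()

odd-board-no-circuit : ∀ {r s m n} → parity (r + s) ≡ 1ℙ → parity m ≡ 1ℙ → parity n ≡ 1ℙ →
                       ¬ LeaperGraphHasHamCircuit r s m n
odd-board-no-circuit {m = m} {n} odd m-odd n-odd H = 0ℙ≢1ℙ (begin
  0ℙ                     ≡⟨ sym (ℙₚ.p+p≡0ℙ (parity W)) ⟩
  parity W ℙ.+ parity W  ≡⟨ sym (ℙₚ.+-homo-+ W W) ⟩
  parity (W + W)         ≡⟨ cong parity (sym (alternating⇒length≡2*oddCount (colour ∘ vertex) colour-alternates)) ⟩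
  parity (suc len)       ≡⟨ cong parity circuit-length ⟩
  parity (m * n)         ≡⟨ ℙₚ.*-homo-* m n ⟩
  parity m ℙ.* parity n  ≡⟨ cong₂ ℙ._*_ m-odd n-odd ⟩
  1ℙ                     ∎)
  where
  open ≡-Reasoning
  open HamiltonianCircuit H
  open BoardCircuit H
  W = oddCount (colour ∘ vertex)
  colour-alternates : Alternating (colour ∘ vertex)
  colour-alternates i = trans (colour-step (vertex i) (vertex (next i)) (step i)) odd
  0ℙ≢1ℙ : 0ℙ ≢ 1ℙ
  0ℙ≢1ℙ ()

IndependentColumns : (r s : ℕ) → (ℕ → Parity) → Set
IndependentColumns r s B = ∀ z z' → ∣ z - z' ∣ ≡ r ⊎ ∣ z - z' ∣ ≡ s → B z ℙ.* B z' ≡ 0ℙ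

DenseIndependentColumns : (r s m : ℕ) → Set
DenseIndependentColumns r s m =
  Σ[ B ∈ (ℕ → Parity) ] IndependentColumns r s B × m ≤ oddCount {m} (B ∘ toℕ) + oddCount {m} (B ∘ toℕ)

dense-independent-columns-swap : ∀ {r s m} → DenseIndependentColumns r s m → DenseIndependentColumns s r m
dense-independent-columns-swap (B , independent , dense) = B , (λ z z' → independent z z' ∘ ⊎-swap) , dense

-- The odd columns and the colours both alternate along the circuit, so their sum is constant on the board.
dense-independent-columns-no-circuit : ∀ {r s m n} → parity (r + s) ≡ 1ℙ → 2 ≤ n → DenseIndependentColumns r s m →
                                       ¬ LeaperGraphHasHamCircuit r s m n
dense-independent-columns-no-circuit {m = m} {n = n@(suc (suc n-2))} odd (s≤s (s≤s z≤n)) (B , independent , dense) H =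
  column-colours-differ {n = n-2} (B (toℕ x₀)) x₀
    (constant-on-circuit columnColour columnColour-invariant (x₀ , zero) (x₀ , suc zero))
  where
  open HamiltonianCircuit H
  open Circuit H
  open BoardCircuit H
  x₀ = proj₁ (vertex zero)
  column : Square m n → Parity
  column v = B (toℕ (proj₁ v))
  columnColour : Square m n → Parity
  columnColour v = column v ℙ.+ colour v

  half-odd : suc len ≤ oddCount (column ∘ vertex) + oddCount (column ∘ vertex)
  half-odd = begin
    suc len                                                  ≡⟨ circuit-length ⟩
    m * n                                                    ≤⟨ *-monoˡ-≤ n dense ⟩
    (Q + Q) * n                                              ≡⟨ *-distribʳ-+ n Q Q ⟩
    Q * n + Q * n                                            ≡⟨ cong₂ _+_ (*-comm Q n) (*-comm Q n) ⟩
    n * Q + n * Q                                            ≡⟨ sym (cong₂ _+_ column-count column-count) ⟩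
    oddCount (column ∘ vertex) + oddCount (column ∘ vertex)  ∎
    where
    open ≤-Reasoning
    Q = oddCount {m} (B ∘ toℕ)
    column-count : oddCount (column ∘ vertex) ≡ n * Q
    column-count = oddCount-columns (B ∘ toℕ)

  column-alternates : Alternating (column ∘ vertex)
  column-alternates = sparse∧half-odd⇒alternating (column ∘ vertex)
    (λ i → independent (toℕ (proj₁ (vertex i))) (toℕ (proj₁ (vertex (next i))))
                       (column-step (vertex i) (vertex (next i)) (step i)))
    half-odd

  columnColour-invariant : ∀ i → columnColour (vertex (next i)) ≡ columnColour (vertex i)
  columnColour-invariant i = +≡0ℙ⇒≡ _ _ (begin
    columnColour u ℙ.+ columnColour v
      ≡⟨ interchange (column u) (colour u) (column v) (colour v) ⟩
    (column u ℙ.+ column v) ℙ.+ (colour u ℙ.+ colour v)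
      ≡⟨ cong₂ ℙ._+_ (column-alternates i) (trans (colour-step u v (step i)) odd) ⟩
    0ℙ
      ∎)
    where
    open ≡-Reasoning
    u = vertex i
    v = vertex (next i)

-- Independent columns from residues modulo r + s

-- With t + t' = M and a t ≡ 1 (mod M), the label a (z + 1) + c (mod M) goes up by one under z ↦ z + t
-- and down by one under z ↦ z + t', so columns t or t' apart carry cyclically consecutive labels.
module ColumnLabelling {M' t t' a : ℕ} (t+t'≡M : t + t' ≡ suc M') (a*t≡1 : a * t % suc M' ≡ 1) where

  M : ℕ
  M = suc M'

  label : ℕ → ℕ → ℕ
  label c z = (a * suc z + c) % M

  private
    label-argument-+ : ∀ c z n → a * suc (z + n) + c ≡ a * suc z + c + a * n
    label-argument-+ c z n = solve (a ∷ c ∷ z ∷ n ∷ [])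

  label<M : ∀ c z → label c z < M
  label<M c z = m%n<n (a * suc z + c) M

  label-suc : ∀ c z → label (suc c) z ≡ suc (label c z) % M
  label-suc c z = trans (cong (_% M) (+-suc (a * suc z) c)) (sym ([m+n%d]%d≡[m+n]%d 1 (a * suc z + c) M))

  label-+t : ∀ c z → label c (z + t) ≡ suc (label c z) % M
  label-+t c z = begin
    (a * suc (z + t) + c) % M        ≡⟨ cong (_% M) (label-argument-+ c z t) ⟩
    (a * suc z + c + a * t) % M      ≡⟨ sym ([m+n%d]%d≡[m+n]%d (a * suc z + c) (a * t) M) ⟩
    (a * suc z + c + a * t % M) % M  ≡⟨ cong (λ k → (a * suc z + c + k) % M) a*t≡1 ⟩
    (a * suc z + c + 1) % M          ≡⟨ cong (_% M) (+-comm (a * suc z + c) 1) ⟩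
    suc (a * suc z + c) % M          ≡⟨ sym ([m+n%d]%d≡[m+n]%d 1 (a * suc z + c) M) ⟩
    suc (label c z) % M              ∎
    where open ≡-Reasoning

  label-+M : ∀ c z → label c (z + M) ≡ label c z
  label-+M c z = trans (cong (_% M) (label-argument-+ c z M)) ([m+kn]%n≡m%n (a * suc z + c) a M)

  label-+t' : ∀ c z → suc (label c (z + t')) % M ≡ label c z
  label-+t' c z = begin
    suc (label c (z + t')) % M  ≡⟨ sym (label-+t c (z + t')) ⟩
    label c (z + t' + t)        ≡⟨ cong (label c) (trans (+-assoc z t' t) (cong (z +_) (trans (+-comm t' t) t+t'≡M))) ⟩
    label c (z + M)             ≡⟨ label-+M c z ⟩
    label c z                   ∎
    where open ≡-Reasoning

  consecutive-labels : ∀ c z z' → ∣ z - z' ∣ ≡ t ⊎ ∣ z - z' ∣ ≡ t' →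
                       label c z' ≡ suc (label c z) % M ⊎ label c z ≡ suc (label c z') % M
  consecutive-labels c z z' (inj₁ dist) with ∣m-n∣≡o⇒n≡m+o⊎m≡n+o z z' dist
  ... | inj₁ refl = inj₁ (label-+t c z)
  ... | inj₂ refl = inj₂ (label-+t c z')
  consecutive-labels c z z' (inj₂ dist) with ∣m-n∣≡o⇒n≡m+o⊎m≡n+o z z' dist
  ... | inj₁ refl = inj₂ (sym (label-+t' c z))
  ... | inj₂ refl = inj₁ (sym (label-+t' c z'))

  odd-labels-independent : ∀ c → IndependentColumns t t' (parity ∘ label c)
  odd-labels-independent c z z' dist with consecutive-labels c z z' dist
  ... | inj₁ eq rewrite eq = parity-*-suc-% (label<M c z)
  ... | inj₂ eq rewrite eq = trans (ℙₚ.*-comm _ (parity (label c z'))) (parity-*-suc-% (label<M c z'))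

  M∣a*w⇒M∣w : ∀ {w} → M ∣ a * w → M ∣ w
  M∣a*w⇒M∣w {w} M∣a*w = ∣m+n∣m⇒∣n (subst (M ∣_) expand (∣m⇒∣m*n t M∣a*w)) (n∣m*n (w * q))
    where
    open ≡-Reasoning
    q = a * t / M
    expand : a * w * t ≡ w * q * M + w
    expand = begin
      a * w * t        ≡⟨ solve (a ∷ w ∷ t ∷ []) ⟩
      w * (a * t)      ≡⟨ cong (w *_) (trans (m≡m%n+[m/n]*n (a * t) M) (cong (_+ q * M) a*t≡1)) ⟩
      w * (1 + q * M)  ≡⟨ distrib w q M ⟩
      w * q * M + w    ∎
      where
      distrib : ∀ w q n → w * (1 + q * n) ≡ w * q * n + w
      distrib = solve-∀

  label-M'≡M'⇒M∣1+z : ∀ z → label M' z ≡ M' → M ∣ suc z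
  label-M'≡M'⇒M∣1+z z eq = M∣a*w⇒M∣w (m%n≡0⇒n∣m (a * suc z) M (begin
    a * suc z % M         ≡⟨ sym ([m+n]%n≡m%n (a * suc z) M) ⟩
    label M z             ≡⟨ label-suc M' z ⟩
    suc (label M' z) % M  ≡⟨ cong (λ k → suc k % M) eq ⟩
    M % M                 ≡⟨ n%n≡0 M ⟩
    0                     ∎))
    where open ≡-Reasoning

  -- Shifting c by one turns the odd labels into the nonzero even ones, so only the label M − 1 is
  -- odd for neither offset; below 2M − 1 this happens for z = M − 1 alone.
  labels-cover : ∀ z → z < M + M' → z ≢ M' → 1 ≤ weight (parity (label M' z)) + weight (parity (label M z))
  labels-cover z z<M+M' z≢M' = ≤-reflexive (sym (weight-+≡1ℙ (parity u) (parity (label M z)) (begin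
    parity u ℙ.+ parity (label M z)  ≡⟨ cong (λ k → parity u ℙ.+ parity k) label-M≡1+u ⟩
    parity u ℙ.+ parity (suc u)      ≡⟨ cong (parity u ℙ.+_) (parity-suc u) ⟩
    parity u ℙ.+ parity u ⁻¹         ≡⟨ ℙₚ.p+p⁻¹≡1ℙ (parity u) ⟩
    1ℙ                               ∎)))
    where
    open ≡-Reasoning
    u = label M' z
    1+z<M+M : suc z < M + M
    1+z<M+M = ≤-<-trans z<M+M' (+-monoʳ-< M (n<1+n M'))
    u<M' : u < M'
    u<M' = ≤∧≢⇒< (≤-pred (label<M M' z))
             (λ u≡M' → z≢M' (suc-injective (n∣m∧0<m<n+n⇒m≡n (label-M'≡M'⇒M∣1+z z u≡M') z<s 1+z<M+M)))
    label-M≡1+u : label M z ≡ suc u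
    label-M≡1+u = trans (label-suc M' z) (m<n⇒m%n≡m (s≤s u<M'))

  oddLabels : ℕ → ℕ → ℕ
  oddLabels c m = oddCount {m} (parity ∘ label c ∘ toℕ)

  oddLabels-cover : ∀ {m} → m ≤ M + M' → m ≤ suc (oddLabels M' m + oddLabels M m)
  oddLabels-cover {m} m≤M+M' =
    subst (λ k → m ≤ suc k) (∑-distrib-+ {m} (weight ∘ parity ∘ label M' ∘ toℕ) (weight ∘ parity ∘ label M ∘ toℕ))
      (sum-≥-length-but-one _ M' (λ i → labels-cover (toℕ i) (≤-trans (toℕ<n i) m≤M+M')))

  dense-odd-label-columns : ∀ {m} → parity m ≡ 0ℙ → m < 2 * M → DenseIndependentColumns t t' m
  dense-odd-label-columns {m} m-even m<2M with even⇒double m m-even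
  ... | h , refl with h+h≤1+p+q⇒h≤p⊎h≤q h (oddLabels M' m) (oddLabels M m) (oddLabels-cover m≤M+M')
    where
    m≤M+M' : m ≤ M + M'
    m≤M+M' = ≤-pred (subst (m <_) (trans (+-suc M (M' + 0)) (cong (λ k → suc (M + k)) (+-identityʳ M'))) m<2M)
  ... | inj₁ h≤Q = parity ∘ label M' , odd-labels-independent M' , +-mono-≤ h≤Q h≤Q
  ... | inj₂ h≤Q = parity ∘ label M  , odd-labels-independent M  , +-mono-≤ h≤Q h≤Q

-- Bézout gives a r ≡ 1 or a r ≡ −1 (mod r + s); in the second case a s ≡ 1 and r, s swap roles.
coprime⇒dense-independent-columns : ∀ {r' s m} → 1 ≤ s → Bézout.Identity 1 (suc r') (suc r' + s) → parity m ≡ 0ℙ →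
                                    m < 2 * (suc r' + s) → DenseIndependentColumns (suc r') s m
coprime⇒dense-independent-columns {r'} {s} 1≤s (Bézout.+- x y eq) m-even m<2M =
  ColumnLabelling.dense-odd-label-columns {a = x} refl inverse m-even m<2M
  where
  inverse : x * suc r' % (suc r' + s) ≡ 1
  inverse = trans (cong (_% (suc r' + s)) (sym eq)) (trans ([m+kn]%n≡m%n 1 y (suc r' + s)) (1%[1+r+s]≡1 r' s 1≤s))
coprime⇒dense-independent-columns {r'} {s} 1≤s (Bézout.-+ x y eq) m-even m<2M =
  dense-independent-columns-swap (ColumnLabelling.dense-odd-label-columns {a = x} (+-comm s (suc r')) inverse m-even m<2M)
  where
  M = suc r' + s
  inverse : x * s % M ≡ 1
  inverse = begin
    x * s % M                       ≡⟨ sym ([m+kn]%n≡m%n (x * s) y M) ⟩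
    (x * s + y * M) % M             ≡⟨ cong (λ k → (x * s + k) % M) (sym eq) ⟩
    (x * s + (1 + x * suc r')) % M  ≡⟨ cong (_% M) (regroup x s r') ⟩
    (1 + x * M) % M                 ≡⟨ [m+kn]%n≡m%n 1 x M ⟩
    1 % M                           ≡⟨ 1%[1+r+s]≡1 r' s 1≤s ⟩
    1                               ∎
    where
    open ≡-Reasoning
    regroup : ∀ x s r' → x * s + (1 + x * suc r') ≡ 1 + x * (suc r' + s)
    regroup = solve-∀

coprime-leaper-no-circuit : ∀ {r' s m n} → 1 ≤ s → parity (suc r' + s) ≡ 1ℙ → Bézout.Identity 1 (suc r') (suc r' + s) →
                            2 ≤ m → m ≤ n → n < 2 * (suc r' + s) → ¬ LeaperGraphHasHamCircuit (suc r') s m n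
coprime-leaper-no-circuit {m = m} {n} 1≤s odd bézout 2≤m m≤n n<2M with parity m in m-parity | parity n in n-parity
... | 0ℙ | _  = dense-independent-columns-no-circuit odd (≤-trans 2≤m m≤n)
                  (coprime⇒dense-independent-columns 1≤s bézout m-parity (≤-<-trans m≤n n<2M))
... | 1ℙ | 0ℙ = dense-independent-columns-no-circuit odd 2≤m (coprime⇒dense-independent-columns 1≤s bézout n-parity n<2M)
                  ∘ leaper-transpose
... | 1ℙ | 1ℙ = odd-board-no-circuit odd m-parity n-parity

theorem8 : (r s m n : ℕ) → 1 ≤ r → r ≤ s → 2 * s ≤ m → m ≤ n → n < 2 * (r + s) →
    ¬ LeaperGraphHasHamCircuit r s m n
theorem8 (suc r') s m n _ r≤s 2s≤m m≤n n<2M = by-cases (parity (suc r' + s)) refl (Bézout.lemma (suc r') (suc r' + s))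
  where
  1≤s : 1 ≤ s
  1≤s = ≤-trans (s≤s z≤n) r≤s
  2≤m : 2 ≤ m
  2≤m = ≤-trans (*-monoʳ-≤ 2 1≤s) 2s≤m
  by-cases : ∀ p → parity (suc r' + s) ≡ p → Bézout.Lemma (suc r') (suc r' + s) → ¬ LeaperGraphHasHamCircuit (suc r') s m n
  by-cases 0ℙ even _                                   = even-leaper-no-circuit even (≤-trans 2≤m m≤n)
  by-cases 1ℙ _    (Bézout.result 0 gcd _)              = contradiction (0∣⇒≡0 (proj₁ (GCD.commonDivisor gcd))) λ ()
  by-cases 1ℙ odd  (Bézout.result 1 _ bézout)           = coprime-leaper-no-circuit 1≤s odd bézout 2≤m m≤n n<2M
  by-cases 1ℙ _    (Bézout.result (suc (suc d)) gcd _) =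
    common-divisor-no-circuit (s≤s (s≤s z≤n)) d∣r (∣m+n∣m⇒∣n d∣r+s d∣r) 2≤m
    where
    d∣r = proj₁ (GCD.commonDivisor gcd)
    d∣r+s = proj₂ (GCD.commonDivisor gcd)
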